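{- Let $(G,+)$ be a finite abelian group, $n$ a positive integer, $W=G\wr S_n$, $\underline\sigma\in\Sigma_n(G)$, let $H=H_{\underline\sigma}$ be the stabiliser of a $\underline\sigma$-tabloid and let $Y$ be a nonempty subset of $W$. (a) If $Y$ is a $\underline\sigma$-clique, then $|Y|\le|W|/|H|$, with equality if and only if $Y$ is $\underline\sigma$-transitive. (b) If $Y$ is $\underline\sigma$-transitive, then $|Y|\ge|W|/|H|$, with equality if and only if $Y$ is a $\underline\sigma$-clique. In both cases, equality implies that $Y$ is sharply $\underline\sigma$-transitive.
   Context: $[n]=\{1,\dots,n\}$. $W=G\wr S_n$ consists of pairs $(g,\pi)$, $g\in G^n$, $\pi\in S_n$, with $(f,\pi)(g,\sigma)=(f+g^\pi,\pi\sigma)$, $g^\pi=(g_{\pi^{ -1}(1)},\dots,g_{\pi^{ -1}(n)})$. $\Sigma_n(G)$ is the set of maps $\underline\sigma$ from the set of subgroups of $G$ to partitions with $\sum_{U\le G}|\underline\sigma(U)|=n$. Tabloids: a $\underline\sigma$-tableau consists of, for each $U\le G$, the Young diagram of $\underline\sigma(U)$ with boxes filled by pairs $(c,i)$, $c\in G/U$, $i\in[n]$, all $i$ pairwise distinct; row-equivalence classes are $\underline\sigma$-tabloids; $W$ acts entrywise by $(g,\pi)\cdot(c,i)=(c+g_{\pi(i)},\pi(i))$. A nonempty $Y\subseteq W$ is $\underline\sigma$-transitive if there is $c>0$ such that for any two $\underline\sigma$-tabloids $a,b$ exactly $c$ elements $y\in Y$ satisfy $ya=b$; sharply if $c=1$.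 $Y$ is a $\underline\sigma$-clique if for all distinct $x,y\in Y$ no $\underline\sigma$-tabloid is fixed by $x^{ -1}y$. -}

module Defs where

open import Data.Nat using (ℕ; zero; suc; _<_; _≥_)
open import Data.Nat.Properties using () renaming (_≟_ to _≟ℕ_)
open import Data.Bool using (Bool; true; false) renaming (_≟_ to _≟B_)
open import Data.Fin using (Fin; toℕ) renaming (_≟_ to _≟F_)
open import Data.Fin.Subset using (Subset; _∈_)
open import Data.Fin.Subset.Properties using (_∈?_)
open import Data.Fin.Properties using (all?; any?)
open import Data.Vec using (Vec; []; _∷_; lookup; tabulate)
open import Data.Vec.Properties using (≡-dec)
open import Data.Nat.ListAction using (sum)
open import Data.List using (List; []; _∷_; [_]; _++_; length; filter; map; allFin; cartesianProduct; head)
import Data.List as L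
open import Data.List.Relation.Unary.Linked using (Linked)
open import Data.List.Relation.Unary.All using (All)
open import Data.List.Membership.Propositional using () renaming (_∈_ to _∈L_)
open import Data.Maybe using (fromMaybe)
open import Data.Product using (Σ; ∃; _×_; _,_; proj₁; proj₂)
open import Algebra.Structures using (IsAbelianGroup)
open import Relation.Binary.PropositionalEquality using (_≡_; _≢_)
open import Relation.Nullary using (¬_; Dec)
open import Relation.Nullary.Decidable using (_×-dec_; _→-dec_)
open import Relation.Unary using (Pred; Decidable)

count : ∀ {A : Set} {ℓ} {P : Pred A ℓ} → Decidable P → List A → ℕ
count P? xs = length (filter P? xs)

allVecs : ∀ {A : Set} → List A → (m : ℕ) → List (Vec A m)
allVecs xs zero    = [ [] ]
allVecs xs (suc m) = L.concatMap (λ x → map (x ∷_) (allVecs xs m)) xs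

allSubsets : (m : ℕ) → List (Subset m)
allSubsets m = allVecs (true ∷ false ∷ []) m

IsPartition : List ℕ → Set
IsPartition λ′ = All (0 <_) λ′ × Linked _≥_ λ′

record FiniteAbelianGroup : Set where
  infixl 6 _+_
  field
    order : ℕ
    _+_   : Fin order → Fin order → Fin order
    0#    : Fin order
    -_    : Fin order → Fin order
    isAbelianGroup : IsAbelianGroup _≡_ _+_ 0# -_

module Wreath (G : FiniteAbelianGroup) (n : ℕ) where
  open FiniteAbelianGroup G

  k : ℕ
  k = order

  _-ᴳ_ : Fin k → Fin k → Fin k
  x -ᴳ y = x + (- y)

  IsSubgroup : Subset k → Set
  IsSubgroup U = (0# ∈ U)
               × (∀ x y → x ∈ U → y ∈ U → (x + y) ∈ U)
               × (∀ x → x ∈ U → (- x) ∈ U)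

  -- Σ_n(G): a map from subgroups of G to partitions with total size n.
  -- Encoded as a map on all subsets which is the empty partition on
  -- non-subgroups.
  InΣ : (Subset k → List ℕ) → Set
  InΣ σ = (∀ U → IsPartition (σ U))
        × (∀ U → ¬ IsSubgroup U → σ U ≡ [])
        × (sum (map (λ U → sum (σ U)) (allSubsets k)) ≡ n)

  -- A σ-tabloid (row-equivalence class of σ-tableaux) is
  -- determined by recording, for each i ∈ [n], the box-row in which the
  -- unique entry (c , i) lies -- a subgroup U and a row index r of the
  -- diagram of σ(U) -- together with the coset c ∈ G/U.  Cosets are
  -- given by representatives, compared modulo U.

  record Entry : Set where
    constructor entry
    field
      sub   : Subset k
      row   : ℕ
      coset : Fin k
  open Entry public

  TabloidRep : Set
  TabloidRep = Fin n → Entry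

  IsTabloid : (Subset k → List ℕ) → TabloidRep → Set
  IsTabloid σ t =
      (∀ i → row (t i) < length (σ (sub (t i))))
    × (∀ U (r : Fin (length (σ U))) →
         count (λ i → (sub (t i) ≟S U) ×-dec (row (t i) ≟ℕ toℕ r)) (allFin n)
           ≡ L.lookup (σ U) r)
    where
      _≟S_ = ≡-dec _≟B_

  _≈ₑ_ : Entry → Entry → Set
  e ≈ₑ e′ = (sub e ≡ sub e′) × (row e ≡ row e′) × ((coset e -ᴳ coset e′) ∈ sub e)

  _≈ₑ?_ : ∀ e e′ → Dec (e ≈ₑ e′)
  e ≈ₑ? e′ = ≡-dec _≟B_ (sub e) (sub e′) ×-dec (row e ≟ℕ row e′)
             ×-dec ((coset e -ᴳ coset e′) ∈? sub e)

  _≈_ : TabloidRep → TabloidRep → Set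
  a ≈ b = ∀ i → a i ≈ₑ b i

  _≈?_ : ∀ a b → Dec (a ≈ b)
  a ≈? b = all? (λ i → a i ≈ₑ? b i)

  -- The wreath product W = G ≀ S_n.  An element is a pair (g , π) with
  -- g ∈ G^n and π ∈ S_n, π given by its vector of values (π(1),…,π(n)).

  Wel : Set
  Wel = Vec (Fin k) n × Vec (Fin n) n

  IsPerm : Vec (Fin n) n → Set
  IsPerm π = (∀ i j → lookup π i ≡ lookup π j → i ≡ j)
           × (∀ j → ∃ λ i → lookup π i ≡ j)

  IsPerm? : ∀ π → Dec (IsPerm π)
  IsPerm? π = all? (λ i → all? (λ j → (lookup π i ≟F lookup π j) →-dec (i ≟F j)))
              ×-dec all? (λ j → any? (λ i → lookup π i ≟F j))

  InW : Wel → Set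
  InW w = IsPerm (proj₂ w)

  -- inverse permutation (for permutations; found by search)
  invPerm : Vec (Fin n) n → Fin n → Fin n
  invPerm π j = fromMaybe j (head (filter (λ i → lookup π i ≟F j) (allFin n)))

  -- (f,π)(g,σ) = (f + g^π, πσ),  g^π = (g_{π⁻¹(1)},…,g_{π⁻¹(n)})
  _·_ : Wel → Wel → Wel
  (f , π) · (g , σ′) =
    ( tabulate (λ j → lookup f j + lookup g (invPerm π j))
    , tabulate (λ i → lookup π (lookup σ′ i)) )

  _⁻¹ : Wel → Wel
  (g , π) ⁻¹ = (tabulate (λ i → - lookup g (lookup π i)) , tabulate (invPerm π))

  -- action on tabloids: (g,π)·(c,i) = (c + g_{π(i)}, π(i)), entrywise
  act : Wel → TabloidRep → TabloidRep
  act (g , π) t j = entry (sub e) (row e) (coset e + lookup g j)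
    where e = t (invPerm π j)

  Wlist : List Wel
  Wlist = cartesianProduct (allVecs (allFin k) n) (filter IsPerm? (allVecs (allFin n) n))

  ∣W∣ : ℕ
  ∣W∣ = length Wlist

  ∣Stab∣ : TabloidRep → ℕ
  ∣Stab∣ t = count (λ w → act w t ≈? t) Wlist

  -- transitivity and cliques, for a finite subset Y of W given as a
  -- duplicate-free list

  TransitiveWith : (Subset k → List ℕ) → ℕ → List Wel → Set
  TransitiveWith σ c Y = ∀ a b → IsTabloid σ a → IsTabloid σ b →
                           count (λ y → act y a ≈? b) Y ≡ c

  Transitive : (Subset k → List ℕ) → List Wel → Set
  Transitive σ Y = ∃ λ c → (0 < c) × TransitiveWith σ c Y

  SharplyTransitive : (Subset k → List ℕ) → List Wel → Set
  SharplyTransitive σ Y = TransitiveWith σ 1 Y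

  Clique : (Subset k → List ℕ) → List Wel → Set
  Clique σ Y = ∀ x y → x ∈L Y → y ∈L Y → x ≢ y →
                 ∀ t → IsTabloid σ t → ¬ (act ((x ⁻¹) · y) t ≈ t)

{-# OPTIONS --safe #-}
-- Let W act transitively on X and let H be the stabiliser of a point, so that for any two points a, b
-- exactly |H| elements of W carry a to b. Fixing a point a and counting the pairs (w, y) ∈ W × Y with
-- y a = w a gives |Y| |H|, since every y has |H| partners w. In a clique no two elements of Y agree at
-- any point, so every w has at most one partner y: hence |Y| |H| ≤ |W|, with equality exactly when every
-- w has one partner, i.e. when Y is sharply transitive. If Y is transitive with constant c, every w has
-- c partners and |Y| |H| = c |W| ≥ |W|; equality means c = 1, and then two distinct elements of Y that
-- agree at a point would give that point two partners, so Y is a clique.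
-- G ≀ Sₙ acts transitively on σ-tabloids: two of them have equally many entries in every row, so a
-- permutation of [n] matches their rows and a translation in Gⁿ then matches the cosets.
module Submission where

open import Defs
open import Level using (0ℓ)
open import Algebra.Bundles using (AbelianGroup)
import Algebra.Properties.AbelianGroup as AbelianGroupProperties
import Algebra.Properties.CommutativeSemigroup as CommutativeSemigroupProperties
open import Data.Bool using (if_then_else_) renaming (_≟_ to _≟B_)
open import Data.Empty using (⊥)
open import Data.Fin using (Fin; zero; suc; punchIn; toℕ; fromℕ<; _≟_)
open import Data.Fin.Permutation using (Permutation′; _⟨$⟩ʳ_; insert; insert-punchIn)
import Data.Fin.Permutation as Perm
open import Data.Fin.Properties using (toℕ-fromℕ<; all?)
open import Data.Fin.Subset using (Subset) renaming (_∈_ to _∈ₛ_)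
open import Data.Fin.Subset.Properties using (_∈?_)
open import Data.List using (List; []; _∷_; length; filter; map; head; allFin)
import Data.List as List
open import Data.List.Properties using (map-id-local; map-∘; map-cong-local; filter-none)
open import Data.List.Relation.Unary.All as All using (All; []; _∷_)
import Data.List.Relation.Unary.All.Properties as Allₚ
open import Data.List.Relation.Unary.AllPairs as AllPairs using ([]; _∷_)
import Data.List.Relation.Unary.AllPairs.Properties as AllPairsₚ
open import Data.List.Relation.Unary.Any using (here; there)
open import Data.List.Relation.Unary.Unique.Propositional using (Unique)
import Data.List.Relation.Unary.Unique.Propositional.Properties as Unique
open import Data.List.Membership.Propositional using (_∈_)
open import Data.List.Membership.Propositional.Properties using (∈-filter⁺; ∈-filter⁻; ∈-map⁺; ∈-map⁻; ∈-concat⁺′; ∈-allFin; ∈-cartesianProduct⁺; ∈-cartesianProduct⁻)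
open import Data.List.Membership.Propositional.Properties.WithK using (unique∧set⇒bag)
open import Data.List.Relation.Binary.BagAndSetEquality using (∼bag⇒↭)
open import Data.List.Relation.Binary.Permutation.Propositional using (_↭_)
open import Data.List.Relation.Binary.Permutation.Propositional.Properties using (↭-length; filter-↭)
open import Data.Maybe using (fromMaybe)
open import Data.Nat using (ℕ; zero; suc; _≤_; _<_; _+_; _*_; z≤n; s≤s; >-nonZero)
open import Data.Nat.ListAction using (sum)
open import Data.Nat.Properties using (≤-antisym; <-irrefl; n≮0; _<?_; m≤m*n; *-zeroʳ; *-identityʳ; *-cancelˡ-≡; +-cancelˡ-≡; +-cancelʳ-≤; +-monoʳ-≤; +-mono-≤; +-commutativeSemigroup; +-0-commutativeMonoid) renaming (_≟_ to _≟ℕ_)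
import Algebra.Properties.CommutativeMonoid.Sum +-0-commutativeMonoid as FinSum
open import Data.Product using (∃; _×_; _,_; proj₁; proj₂)
import Data.Product as Product
open import Data.Product.Properties using () renaming (≡-dec to ×-≡-dec)
open import Data.Vec using (Vec; []; _∷_; lookup; tabulate)
import Data.Vec.Properties as Vec
open import Data.Vec.Relation.Binary.Pointwise.Extensional using (ext; Pointwise-≡⇒≡)
open import Function using (_∘_; id; _⇔_; mk⇔; Equivalence)
open import Relation.Binary.Definitions using (DecidableEquality)
open import Relation.Binary.PropositionalEquality
open import Relation.Nullary using (¬_; Dec; yes; no; does; contradiction)
open import Relation.Nullary.Decidable using (_×-dec_; _→-dec_; decidable-stable)
open import Relation.Unary using (Pred; Decidable)
open import Algebra.Properties.CommutativeSemigroup +-commutativeSemigroup using (interchange)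

private
  variable
    A B : Set
    xs ys : List A
    P Q : Pred A 0ℓ

indicator : {X : Set} → Dec X → ℕ
indicator d = if does d then 1 else 0

count-∷ : ∀ {x} (P? : Decidable P) → count P? (x ∷ xs) ≡ indicator (P? x) + count P? xs
count-∷ {x = x} P? with P? x
... | yes _ = refl
... | no _ = refl

count-cong : (P? : Decidable P) (Q? : Decidable Q) →
             (∀ {x} → x ∈ xs → P x ⇔ Q x) → count P? xs ≡ count Q? xs
count-cong {xs = []} P? Q? P⇔Q = refl
count-cong {xs = x ∷ xs} P? Q? P⇔Q with P? x | Q? x
... | yes _ | yes _ = cong suc (count-cong P? Q? (P⇔Q ∘ there))
... | yes p | no ¬q = contradiction (Equivalence.to (P⇔Q (here refl)) p) ¬q
... | no ¬p | yes q = contradiction (Equivalence.from (P⇔Q (here refl)) q) ¬p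
... | no _ | no _ = count-cong P? Q? (P⇔Q ∘ there)

count-map : (f : A → B) (P? : Decidable P) (xs : List A) → count P? (map f xs) ≡ count (P? ∘ f) xs
count-map f P? [] = refl
count-map f P? (x ∷ xs) with P? (f x)
... | yes _ = cong suc (count-map f P? xs)
... | no _ = count-map f P? xs

count-↭ : (P? : Decidable P) → xs ↭ ys → count P? xs ≡ count P? ys
count-↭ P? xs↭ys = ↭-length (filter-↭ P? xs↭ys)

module _ {xs : List A} (xs! : Unique xs) {f g : A → A}
         (f-closed : ∀ {x} → x ∈ xs → f x ∈ xs) (g-closed : ∀ {x} → x ∈ xs → g x ∈ xs)
         (g∘f : ∀ {x} → x ∈ xs → g (f x) ≡ x) (f∘g : ∀ {x} → x ∈ xs → f (g x) ≡ x) where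

  map-↭ : map f xs ↭ xs
  map-↭ = ∼bag⇒↭ (unique∧set⇒bag (Unique.map⁻ (subst Unique (sym map-g∘f) xs!)) xs! (mk⇔ into onto))
    where
    map-g∘f : map g (map f xs) ≡ xs
    map-g∘f = trans (sym (map-∘ xs)) (map-id-local (All.tabulate g∘f))
    into : ∀ {y} → y ∈ map f xs → y ∈ xs
    into y∈ with ∈-map⁻ f y∈
    ... | _ , x∈ , refl = f-closed x∈
    onto : ∀ {y} → y ∈ xs → y ∈ map f xs
    onto y∈ = subst (_∈ map f xs) (f∘g y∈) (∈-map⁺ f (g-closed y∈))

  count-∘-bijection : (P? : Decidable P) → count (P? ∘ f) xs ≡ count P? xs
  count-∘-bijection P? = trans (sym (count-map f P? xs)) (count-↭ P? map-↭)

unique-length≤1 : Unique xs → (∀ {x y} → x ∈ xs → y ∈ xs → x ≢ y → ⊥) → length xs ≤ 1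
unique-length≤1 {xs = []} _ _ = z≤n
unique-length≤1 {xs = _ ∷ []} _ _ = s≤s z≤n
unique-length≤1 {xs = _ ∷ _ ∷ _} ((x≢y ∷ _) ∷ _) no-two =
  contradiction x≢y (no-two (here refl) (there (here refl)))

2≤length : ∀ {x y : A} → x ∈ xs → y ∈ xs → x ≢ y → 2 ≤ length xs
2≤length {xs = _ ∷ _ ∷ _} _ _ _ = s≤s (s≤s z≤n)
2≤length {xs = _ ∷ []} (here refl) (here refl) x≢y = contradiction refl x≢y

count≤1 : (P? : Decidable P) → Unique xs →
          (∀ {x y} → x ∈ xs → y ∈ xs → P x → P y → x ≢ y → ⊥) → count P? xs ≤ 1
count≤1 {xs = xs} P? xs! at-most-one = unique-length≤1 (Unique.filter⁺ P? xs!) at-most-one′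
  where
  at-most-one′ : ∀ {x y} → x ∈ filter P? xs → y ∈ filter P? xs → x ≢ y → ⊥
  at-most-one′ x∈ y∈ with ∈-filter⁻ P? x∈ | ∈-filter⁻ P? y∈
  ... | x∈xs , px | y∈xs , py = at-most-one x∈xs y∈xs px py

2≤count : ∀ {x y} (P? : Decidable P) → x ∈ xs → y ∈ xs → x ≢ y → P x → P y → 2 ≤ count P? xs
2≤count P? x∈ y∈ x≢y px py = 2≤length (∈-filter⁺ P? x∈ px) (∈-filter⁺ P? y∈ py) x≢y

head-filter-satisfies : ∀ {x} (P? : Decidable P) (d : A) → x ∈ xs → P x →
                        P (fromMaybe d (head (filter P? xs)))
head-filter-satisfies {xs = y ∷ xs} P? d x∈ px with P? y | x∈
... | yes py | _ = py
... | no ¬py | here refl = contradiction px ¬py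
... | no _ | there x∈xs = head-filter-satisfies P? d x∈xs px

∑ : List A → (A → ℕ) → ℕ
∑ xs f = sum (map f xs)

module _ {f g : A → ℕ} where

  ∑-cong : (∀ {x} → x ∈ xs → f x ≡ g x) → ∑ xs f ≡ ∑ xs g
  ∑-cong f≡g = cong sum (map-cong-local (All.tabulate f≡g))

  ∑-+ : ∀ xs → ∑ xs (λ x → f x + g x) ≡ ∑ xs f + ∑ xs g
  ∑-+ [] = refl
  ∑-+ (x ∷ xs) = trans (cong (f x + g x +_) (∑-+ xs)) (interchange (f x) (g x) _ _)

∑-const : {f : A → ℕ} {c : ℕ} → (∀ {x} → x ∈ xs → f x ≡ c) → ∑ xs f ≡ length xs * c
∑-const {xs = []} _ = refl
∑-const {xs = x ∷ xs} f≡c = cong₂ _+_ (f≡c (here refl)) (∑-const (f≡c ∘ there))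

count≡∑ : (P? : Decidable P) (xs : List A) → count P? xs ≡ ∑ xs (indicator ∘ P?)
count≡∑ P? [] = refl
count≡∑ P? (x ∷ xs) = trans (count-∷ P?) (cong (indicator (P? x) +_) (count≡∑ P? xs))

∑-count-swap : {R : A → B → Set} (R? : ∀ x y → Dec (R x y)) (xs : List A) (ys : List B) →
               ∑ xs (λ x → count (R? x) ys) ≡ ∑ ys (λ y → count (λ x → R? x y) xs)
∑-count-swap R? [] ys = sym (trans (∑-const {xs = ys} (λ _ → refl)) (*-zeroʳ (length ys)))
∑-count-swap R? (x ∷ xs) ys = begin
  count (R? x) ys + ∑ xs (λ x → count (R? x) ys)
    ≡⟨ cong₂ _+_ (count≡∑ (R? x) ys) (∑-count-swap R? xs ys) ⟩
  ∑ ys (λ y → indicator (R? x y)) + ∑ ys (λ y → count (λ x → R? x y) xs)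
    ≡⟨ ∑-+ ys ⟨
  ∑ ys (λ y → indicator (R? x y) + count (λ x → R? x y) xs)
    ≡⟨ ∑-cong {xs = ys} (λ {y} _ → count-∷ {xs = xs} {x = x} (λ x → R? x y)) ⟨
  ∑ ys (λ y → count (λ x → R? x y) (x ∷ xs)) ∎
  where open ≡-Reasoning

module _ {f : A → ℕ} where

  ∑≤length : (∀ {x} → x ∈ xs → f x ≤ 1) → ∑ xs f ≤ length xs
  ∑≤length {xs = []} _ = z≤n
  ∑≤length {xs = x ∷ xs} f≤1 = +-mono-≤ (f≤1 (here refl)) (∑≤length (f≤1 ∘ there))

  ∑≡length⇒≡1 : (∀ {x} → x ∈ xs → f x ≤ 1) → ∑ xs f ≡ length xs → ∀ {x} → x ∈ xs → f x ≡ 1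
  ∑≡length⇒≡1 {xs = x ∷ xs} f≤1 ∑≡ = pointwise
    where
    fx≡1 : f x ≡ 1
    fx≡1 = ≤-antisym (f≤1 (here refl)) (+-cancelʳ-≤ (length xs) 1 (f x)
      (subst (_≤ f x + length xs) ∑≡ (+-monoʳ-≤ (f x) (∑≤length (f≤1 ∘ there)))))
    rest : ∑ xs f ≡ length xs
    rest = +-cancelˡ-≡ 1 (∑ xs f) (length xs) (subst (λ v → v + ∑ xs f ≡ suc (length xs)) fx≡1 ∑≡)
    pointwise : ∀ {y} → y ∈ x ∷ xs → f y ≡ 1
    pointwise (here refl) = fx≡1
    pointwise (there y∈) = ∑≡length⇒≡1 (f≤1 ∘ there) rest y∈

count-tabulate≡∑ : ∀ {A : Set} {P : Pred A 0ℓ} (P? : Decidable P) {n} (h : Fin n → A) →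
                   count P? (List.tabulate h) ≡ FinSum.sum (indicator ∘ P? ∘ h)
count-tabulate≡∑ P? {zero} h = refl
count-tabulate≡∑ P? {suc n} h =
  trans (count-∷ P?) (cong (indicator (P? (h zero)) +_) (count-tabulate≡∑ P? (h ∘ suc)))

module _ {A : Set} (_≟_ : DecidableEquality A) where

  -- Fibres are measured by Fin-indexed sums so that FinSum.sum-remove can take out any index.
  private
    fibre : ∀ {n} → (Fin n → A) → A → ℕ
    fibre f x = FinSum.sum (λ i → indicator (f i ≟ x))

    inhabited : ∀ {n} (g : Fin n → A) {x} → 0 < fibre g x → ∃ λ j → g j ≡ x
    inhabited {suc n} g {x} pos with g zero ≟ x
    ... | yes gz≡x = zero , gz≡x
    ... | no _ = Product.map suc id (inhabited (g ∘ suc) pos)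

    permute : ∀ {n} {f g : Fin n → A} → (∀ x → fibre f x ≡ fibre g x) →
              ∃ λ (ρ : Permutation′ n) → ∀ i → g (ρ ⟨$⟩ʳ i) ≡ f i
    permute {zero} _ = Perm.id , λ ()
    permute {suc n} {f} {g} same = insert zero j ρ , agree
      where
      f₀-counted : 0 < fibre f (f zero)
      f₀-counted rewrite ≡-≟-identity _≟_ (refl {x = f zero}) = s≤s z≤n
      f₀-in-g : ∃ λ j → g j ≡ f zero
      f₀-in-g = inhabited g (subst (0 <_) (same (f zero)) f₀-counted)
      j : Fin (suc n)
      j = proj₁ f₀-in-g
      gj≡f₀ : g j ≡ f zero
      gj≡f₀ = proj₂ f₀-in-g
      same′ : ∀ x → fibre (f ∘ suc) x ≡ fibre (g ∘ punchIn j) x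
      same′ x = +-cancelˡ-≡ (indicator (f zero ≟ x)) _ _ (begin
        fibre f x
          ≡⟨ same x ⟩
        fibre g x
          ≡⟨ FinSum.sum-remove {i = j} (λ i → indicator (g i ≟ x)) ⟩
        indicator (g j ≟ x) + fibre (g ∘ punchIn j) x
          ≡⟨ cong (λ y → indicator (y ≟ x) + fibre (g ∘ punchIn j) x) gj≡f₀ ⟩
        indicator (f zero ≟ x) + fibre (g ∘ punchIn j) x ∎)
        where open ≡-Reasoning
      ρ : Permutation′ n
      ρ = proj₁ (permute same′)
      agree : ∀ i → g (insert zero j ρ ⟨$⟩ʳ i) ≡ f i
      agree zero = gj≡f₀
      agree (suc i) = trans (cong g (insert-punchIn zero j ρ i)) (proj₂ (permute same′) i)

  equal-fibres⇒permutation : ∀ {n} {f g : Fin n → A} →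
    (∀ x → count (λ i → f i ≟ x) (allFin n) ≡ count (λ i → g i ≟ x) (allFin n)) →
    ∃ λ (ρ : Permutation′ n) → ∀ i → g (ρ ⟨$⟩ʳ i) ≡ f i
  equal-fibres⇒permutation {f = f} {g} same = permute λ x →
    trans (sym (count-tabulate≡∑ (λ i → f i ≟ x) id)) (trans (same x) (count-tabulate≡∑ (λ i → g i ≟ x) id))

-- Finite groups acting on sets

-- The group is the part of Carrier cut out by IsElement (a pair of vectors lies in G ≀ Sₙ only when its
-- second component is a permutation), so the group laws are only required there.
record FiniteGroup : Set₁ where
  field
    Carrier            : Set
    IsElement          : Carrier → Set
    elements           : List Carrier
    elements-unique    : Unique elements
    ∈-elements         : ∀ {x} → IsElement x → x ∈ elements
    elements-IsElement : ∀ {x} → x ∈ elements → IsElement x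
    _·_                : Carrier → Carrier → Carrier
    _⁻¹                : Carrier → Carrier
    ε                  : Carrier
    ·-IsElement        : ∀ {x y} → IsElement x → IsElement y → IsElement (x · y)
    ⁻¹-IsElement       : ∀ {x} → IsElement x → IsElement (x ⁻¹)
    assoc              : ∀ {x y z} → IsElement x → IsElement y → IsElement z → (x · y) · z ≡ x · (y · z)
    identityˡ          : ∀ {x} → IsElement x → ε · x ≡ x
    identityʳ          : ∀ {x} → IsElement x → x · ε ≡ x
    inverseˡ           : ∀ {x} → IsElement x → (x ⁻¹) · x ≡ ε
    inverseʳ           : ∀ {x} → IsElement x → x · (x ⁻¹) ≡ ε

-- ≈ need only be an equivalence on points satisfying IsPoint: tabloids are compared through cosets
-- modulo U, which is an equivalence relation only when U is a subgroup.
record GroupAction (W : FiniteGroup) : Set₁ where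
  open FiniteGroup W
  field
    Point       : Set
    IsPoint     : Point → Set
    _≈_         : Point → Point → Set
    _≈?_        : ∀ a b → Dec (a ≈ b)
    ≈-refl      : ∀ {a} → IsPoint a → a ≈ a
    ≈-sym       : ∀ {a b} → IsPoint a → a ≈ b → b ≈ a
    ≈-trans     : ∀ {a b c} → IsPoint a → a ≈ b → b ≈ c → a ≈ c
    act         : Carrier → Point → Point
    act-IsPoint : ∀ {w a} → IsElement w → IsPoint a → IsPoint (act w a)
    act-cong    : ∀ {w a b} → a ≈ b → act w a ≈ act w b
    act-·       : ∀ {x y a} → IsElement x → IsElement y → IsPoint a → act (x · y) a ≈ act x (act y a)
    act-ε       : ∀ {a} → IsPoint a → act ε a ≈ a

module FiniteGroupProperties (W : FiniteGroup) where
  open FiniteGroup W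

  private
    variable
      u v w : Carrier

  ⁻¹-·-cancelˡ : IsElement v → IsElement w → (v ⁻¹) · (v · w) ≡ w
  ⁻¹-·-cancelˡ v∈ w∈ =
    trans (sym (assoc (⁻¹-IsElement v∈) v∈ w∈)) (trans (cong (_· _) (inverseˡ v∈)) (identityˡ w∈))

  ·-⁻¹-cancelˡ : IsElement v → IsElement w → v · ((v ⁻¹) · w) ≡ w
  ·-⁻¹-cancelˡ v∈ w∈ =
    trans (sym (assoc v∈ (⁻¹-IsElement v∈) w∈)) (trans (cong (_· _) (inverseʳ v∈)) (identityˡ w∈))

  ·-⁻¹-cancelʳ : IsElement u → IsElement w → (w · u) · (u ⁻¹) ≡ w
  ·-⁻¹-cancelʳ u∈ w∈ =
    trans (assoc w∈ u∈ (⁻¹-IsElement u∈)) (trans (cong (_ ·_) (inverseʳ u∈)) (identityʳ w∈))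

  ⁻¹-·-cancelʳ : IsElement u → IsElement w → (w · (u ⁻¹)) · u ≡ w
  ⁻¹-·-cancelʳ u∈ w∈ =
    trans (assoc w∈ (⁻¹-IsElement u∈) u∈) (trans (cong (_ ·_) (inverseˡ u∈)) (identityʳ w∈))

  module _ {P : Pred Carrier 0ℓ} (P? : Decidable P) where

    count-translateˡ : IsElement v → count (P? ∘ (v ·_)) elements ≡ count P? elements
    count-translateˡ v∈ = count-∘-bijection elements-unique
      (∈-elements ∘ ·-IsElement v∈ ∘ elements-IsElement)
      (∈-elements ∘ ·-IsElement (⁻¹-IsElement v∈) ∘ elements-IsElement)
      (⁻¹-·-cancelˡ v∈ ∘ elements-IsElement) (·-⁻¹-cancelˡ v∈ ∘ elements-IsElement) P?

    count-translateʳ : IsElement u → count (P? ∘ (_· u)) elements ≡ count P? elements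
    count-translateʳ u∈ = count-∘-bijection elements-unique
      (∈-elements ∘ (λ w∈ → ·-IsElement w∈ u∈) ∘ elements-IsElement)
      (∈-elements ∘ (λ w∈ → ·-IsElement w∈ (⁻¹-IsElement u∈)) ∘ elements-IsElement)
      (·-⁻¹-cancelʳ u∈ ∘ elements-IsElement) (⁻¹-·-cancelʳ u∈ ∘ elements-IsElement) P?

module GroupActionProperties {W : FiniteGroup} (X : GroupAction W) where
  open FiniteGroup W
  open FiniteGroupProperties W
  open GroupAction X

  private
    variable
      u v x y : Carrier
      a b c d : Point

  act-⁻¹-cancel : IsElement v → IsPoint a → act (v ⁻¹) (act v a) ≈ a
  act-⁻¹-cancel {v} {a} v∈ a∈ = ≈-trans (act-IsPoint v⁻¹∈ (act-IsPoint v∈ a∈))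
    (≈-sym (act-IsPoint (·-IsElement v⁻¹∈ v∈) a∈) (act-· v⁻¹∈ v∈ a∈))
    (subst (λ e → act e a ≈ a) (sym (inverseˡ v∈)) (act-ε a∈))
    where
    v⁻¹∈ : IsElement (v ⁻¹)
    v⁻¹∈ = ⁻¹-IsElement v∈

  act-injective : IsElement v → IsPoint a → IsPoint b → act v a ≈ act v b → a ≈ b
  act-injective {v} {a} v∈ a∈ b∈ va≈vb =
    ≈-trans a∈ (≈-sym v⁻¹va∈ (act-⁻¹-cancel v∈ a∈)) (≈-trans v⁻¹va∈ (act-cong va≈vb) (act-⁻¹-cancel v∈ b∈))
    where
    v⁻¹va∈ : IsPoint (act (v ⁻¹) (act v a))
    v⁻¹va∈ = act-IsPoint (⁻¹-IsElement v∈) (act-IsPoint v∈ a∈)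

  fixes⇔agree : IsElement x → IsElement y → IsPoint a → act ((x ⁻¹) · y) a ≈ a ⇔ act y a ≈ act x a
  fixes⇔agree {x} {y} {a} x∈ y∈ a∈ = mk⇔ to from
    where
    x⁻¹∈ : IsElement (x ⁻¹)
    x⁻¹∈ = ⁻¹-IsElement x∈
    x⁻¹y∈ : IsElement ((x ⁻¹) · y)
    x⁻¹y∈ = ·-IsElement x⁻¹∈ y∈
    to : act ((x ⁻¹) · y) a ≈ a → act y a ≈ act x a
    to fixes = ≈-trans (act-IsPoint y∈ a∈)
      (subst (λ e → act e a ≈ act x (act ((x ⁻¹) · y) a)) (·-⁻¹-cancelˡ x∈ y∈) (act-· x∈ x⁻¹y∈ a∈))
      (act-cong fixes)
    from : act y a ≈ act x a → act ((x ⁻¹) · y) a ≈ a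
    from agree = ≈-trans (act-IsPoint x⁻¹y∈ a∈) (act-· x⁻¹∈ y∈ a∈)
      (≈-trans (act-IsPoint x⁻¹∈ (act-IsPoint y∈ a∈)) (act-cong agree) (act-⁻¹-cancel x∈ a∈))

  moves : Point → Point → ℕ
  moves a b = count (λ w → act w a ≈? b) elements

  moves-cong : IsPoint a → IsPoint b → IsPoint c → IsPoint d → a ≈ c → b ≈ d → moves a b ≡ moves c d
  moves-cong {a} {b} {c} {d} a∈ b∈ c∈ d∈ a≈c b≈d =
    count-cong (λ w → act w a ≈? b) (λ w → act w c ≈? d) equiv
    where
    equiv : ∀ {w} → w ∈ elements → act w a ≈ b ⇔ act w c ≈ d
    equiv {w} w∈ = mk⇔
      (λ wa≈b → ≈-trans wc∈ (act-cong (≈-sym a∈ a≈c)) (≈-trans wa∈ wa≈b b≈d))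
      (λ wc≈d → ≈-trans wa∈ (act-cong a≈c) (≈-trans wc∈ wc≈d (≈-sym b∈ b≈d)))
      where
      wa∈ : IsPoint (act w a)
      wa∈ = act-IsPoint (elements-IsElement w∈) a∈
      wc∈ : IsPoint (act w c)
      wc∈ = act-IsPoint (elements-IsElement w∈) c∈

  moves-act-source : IsElement u → IsPoint c → IsPoint b → moves (act u c) b ≡ moves c b
  moves-act-source {u} {c} {b} u∈ c∈ b∈ =
    trans (count-cong (λ w → act w (act u c) ≈? b) (λ w → act (w · u) c ≈? b) equiv)
          (count-translateʳ (λ w → act w c ≈? b) u∈)
    where
    equiv : ∀ {w} → w ∈ elements → act w (act u c) ≈ b ⇔ act (w · u) c ≈ b
    equiv {w} w∈ = mk⇔
      (λ wuc≈b → ≈-trans (act-IsPoint wu∈ c∈) (act-· w∈′ u∈ c∈) wuc≈b)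
      (λ wu·c≈b → ≈-trans (act-IsPoint w∈′ (act-IsPoint u∈ c∈))
                            (≈-sym (act-IsPoint wu∈ c∈) (act-· w∈′ u∈ c∈)) wu·c≈b)
      where
      w∈′ : IsElement w
      w∈′ = elements-IsElement w∈
      wu∈ : IsElement (w · u)
      wu∈ = ·-IsElement w∈′ u∈

  moves-act-target : IsElement v → IsPoint c → IsPoint d → moves c (act v d) ≡ moves c d
  moves-act-target {v} {c} {d} v∈ c∈ d∈ =
    trans (sym (count-translateˡ (λ w → act w c ≈? act v d) v∈))
          (count-cong (λ w → act (v · w) c ≈? act v d) (λ w → act w c ≈? d) equiv)
    where
    equiv : ∀ {w} → w ∈ elements → act (v · w) c ≈ act v d ⇔ act w c ≈ d
    equiv {w} w∈ = mk⇔
      (λ vw·c≈vd → act-injective v∈ (act-IsPoint w∈′ c∈) d∈ (≈-trans (act-IsPoint v∈ (act-IsPoint w∈′ c∈))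
                     (≈-sym (act-IsPoint vw∈ c∈) (act-· v∈ w∈′ c∈)) vw·c≈vd))
      (λ wc≈d → ≈-trans (act-IsPoint vw∈ c∈) (act-· v∈ w∈′ c∈) (act-cong wc≈d))
      where
      w∈′ : IsElement w
      w∈′ = elements-IsElement w∈
      vw∈ : IsElement (v · w)
      vw∈ = ·-IsElement v∈ w∈′

module DoubleCounting {W : FiniteGroup} (X : GroupAction W) where
  open FiniteGroup W
  open GroupAction X
  open GroupActionProperties X

  private
    variable
      a b t : Point

  ActsTransitively : Set
  ActsTransitively = ∀ a b → IsPoint a → IsPoint b → ∃ λ w → IsElement w × act w a ≈ b

  ∣Stab∣ : Point → ℕ
  ∣Stab∣ a = count (λ w → act w a ≈? a) elements

  TransitiveWith : ℕ → List Carrier → Set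
  TransitiveWith c Y = ∀ a b → IsPoint a → IsPoint b → count (λ y → act y a ≈? b) Y ≡ c

  Transitive : List Carrier → Set
  Transitive Y = ∃ λ c → (0 < c) × TransitiveWith c Y

  SharplyTransitive : List Carrier → Set
  SharplyTransitive Y = TransitiveWith 1 Y

  Clique : List Carrier → Set
  Clique Y = ∀ x y → x ∈ Y → y ∈ Y → x ≢ y → ∀ t → IsPoint t → ¬ (act ((x ⁻¹) · y) t ≈ t)

  module _ (transitive : ActsTransitively) where

    moves-constant : ∀ {a b c d} → IsPoint a → IsPoint b → IsPoint c → IsPoint d → moves a b ≡ moves c d
    moves-constant {a} {b} {c} {d} a∈ b∈ c∈ d∈ with transitive c a c∈ a∈ | transitive d b d∈ b∈
    ... | u , u∈ , uc≈a | v , v∈ , vd≈b = begin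
      moves a b                  ≡⟨ moves-cong a∈ b∈ uc∈ vd∈ (≈-sym uc∈ uc≈a) (≈-sym vd∈ vd≈b) ⟩
      moves (act u c) (act v d)  ≡⟨ moves-act-source u∈ c∈ vd∈ ⟩
      moves c (act v d)          ≡⟨ moves-act-target v∈ c∈ d∈ ⟩
      moves c d                  ∎
      where
      open ≡-Reasoning
      uc∈ : IsPoint (act u c)
      uc∈ = act-IsPoint u∈ c∈
      vd∈ : IsPoint (act v d)
      vd∈ = act-IsPoint v∈ d∈

    elements-nonempty : IsPoint t → 0 < length elements
    elements-nonempty {t} t∈ with transitive t t t∈ t∈
    ... | w , w∈ , _ with elements | ∈-elements w∈
    ... | _ ∷ _ | _ = s≤s z≤n

    module _ {Y : List Carrier} (Y-elements : All IsElement Y) (Y-unique : Unique Y) where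

      agreements : Point → Carrier → ℕ
      agreements a w = count (λ y → act y a ≈? act w a) Y

      ∑-agreements : IsPoint a → IsPoint t → ∑ elements (agreements a) ≡ length Y * ∣Stab∣ t
      ∑-agreements {a} {t} a∈ t∈ = begin
        ∑ elements (agreements a)
          ≡⟨ ∑-count-swap (λ w y → act y a ≈? act w a) elements Y ⟩
        ∑ Y (λ y → count (λ w → act y a ≈? act w a) elements)
          ≡⟨ ∑-cong (λ {y} y∈ → count-cong (λ w → act y a ≈? act w a) (λ w → act w a ≈? act y a) (symmetric y∈)) ⟩
        ∑ Y (λ y → moves a (act y a))
          ≡⟨ ∑-const (λ y∈ → moves-constant a∈ (act-IsPoint (All.lookup Y-elements y∈) a∈) t∈ t∈) ⟩
        length Y * ∣Stab∣ t ∎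
        where
        open ≡-Reasoning
        symmetric : ∀ {y w} → y ∈ Y → w ∈ elements → act y a ≈ act w a ⇔ act w a ≈ act y a
        symmetric y∈ w∈ = mk⇔ (≈-sym (act-IsPoint (All.lookup Y-elements y∈) a∈))
                              (≈-sym (act-IsPoint (elements-IsElement w∈) a∈))

      private
        Y-IsElement : ∀ {y} → y ∈ Y → IsElement y
        Y-IsElement = All.lookup Y-elements

      module _ (clique : Clique Y) where

        clique⇒agreements≤1 : IsPoint a → ∀ w → IsElement w → agreements a w ≤ 1
        clique⇒agreements≤1 {a} a∈ w w∈ = count≤1 (λ y → act y a ≈? act w a) Y-unique distinct-agreements
          where
          distinct-agreements : ∀ {x y} → x ∈ Y → y ∈ Y → act x a ≈ act w a → act y a ≈ act w a → x ≢ y → ⊥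
          distinct-agreements {x} {y} x∈ y∈ xa≈wa ya≈wa x≢y =
            clique x y x∈ y∈ x≢y a a∈ (Equivalence.from (fixes⇔agree (Y-IsElement x∈) (Y-IsElement y∈) a∈)
              (≈-trans (act-IsPoint (Y-IsElement y∈) a∈) ya≈wa (≈-sym (act-IsPoint (Y-IsElement x∈) a∈) xa≈wa)))

        clique-bound : IsPoint t → length Y * ∣Stab∣ t ≤ length elements
        clique-bound t∈ = subst (_≤ length elements) (∑-agreements t∈ t∈)
          (∑≤length (λ w∈ → clique⇒agreements≤1 t∈ _ (elements-IsElement w∈)))

        clique-tight⇒sharply : IsPoint t → length Y * ∣Stab∣ t ≡ length elements → SharplyTransitive Y
        clique-tight⇒sharply t∈ tight a b a∈ b∈ with transitive a b a∈ b∈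
        ... | w , w∈ , wa≈b = trans
          (count-cong (λ y → act y a ≈? b) (λ y → act y a ≈? act w a) λ y∈ → mk⇔
             (λ ya≈b → ≈-trans (act-IsPoint (Y-IsElement y∈) a∈) ya≈b (≈-sym wa∈ wa≈b))
             (λ ya≈wa → ≈-trans (act-IsPoint (Y-IsElement y∈) a∈) ya≈wa wa≈b))
          (∑≡length⇒≡1 (λ v∈ → clique⇒agreements≤1 a∈ _ (elements-IsElement v∈))
             (trans (∑-agreements a∈ t∈) tight) (∈-elements w∈))
          where
          wa∈ : IsPoint (act w a)
          wa∈ = act-IsPoint w∈ a∈

      transitiveWith⇒∑ : ∀ {c} → TransitiveWith c Y → IsPoint t → length Y * ∣Stab∣ t ≡ length elements * c
      transitiveWith⇒∑ {t = t} transitiveWith t∈ = trans (sym (∑-agreements t∈ t∈))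
        (∑-const (λ w∈ → transitiveWith t (act _ t) t∈ (act-IsPoint (elements-IsElement w∈) t∈)))

      clique∧transitive⇒tight : Clique Y → Transitive Y → IsPoint t → length Y * ∣Stab∣ t ≡ length elements
      clique∧transitive⇒tight {t} clique (c , c>0 , transitiveWith) t∈ with transitive t t t∈ t∈
      ... | w , w∈ , _ = begin
        length Y * ∣Stab∣ t   ≡⟨ transitiveWith⇒∑ transitiveWith t∈ ⟩
        length elements * c  ≡⟨ cong (length elements *_) c≡1 ⟩
        length elements * 1  ≡⟨ *-identityʳ _ ⟩
        length elements      ∎
        where
        open ≡-Reasoning
        c≡1 : c ≡ 1
        c≡1 = ≤-antisym (subst (_≤ 1) (transitiveWith t (act w t) t∈ (act-IsPoint w∈ t∈))
                                       (clique⇒agreements≤1 clique t∈ w w∈)) c>0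

      transitive-bound : Transitive Y → IsPoint t → length elements ≤ length Y * ∣Stab∣ t
      transitive-bound (suc c , _ , transitiveWith) t∈ =
        subst (length elements ≤_) (sym (transitiveWith⇒∑ transitiveWith t∈)) (m≤m*n (length elements) (suc c))

      transitive∧tight⇒sharply : Transitive Y → IsPoint t → length Y * ∣Stab∣ t ≡ length elements →
                                 SharplyTransitive Y
      transitive∧tight⇒sharply (c , _ , transitiveWith) t∈ tight a b a∈ b∈ =
        trans (transitiveWith a b a∈ b∈) c≡1
        where
        c≡1 : c ≡ 1
        c≡1 = *-cancelˡ-≡ c 1 (length elements) {{>-nonZero (elements-nonempty t∈)}}
          (trans (sym (transitiveWith⇒∑ transitiveWith t∈)) (trans tight (sym (*-identityʳ _))))

      sharply⇒clique : SharplyTransitive Y → Clique Y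
      sharply⇒clique sharply x y x∈ y∈ x≢y a a∈ fixes = <-irrefl refl (subst (2 ≤_) (sharply a (act x a) a∈ xa∈)
        (2≤count (λ z → act z a ≈? act x a) x∈ y∈ x≢y (≈-refl xa∈) ya≈xa))
        where
        xa∈ : IsPoint (act x a)
        xa∈ = act-IsPoint (Y-IsElement x∈) a∈
        ya≈xa : act y a ≈ act x a
        ya≈xa = Equivalence.to (fixes⇔agree (Y-IsElement x∈) (Y-IsElement y∈) a∈) fixes

      clique-case : IsPoint t → Clique Y →
          (length Y * ∣Stab∣ t ≤ length elements)
        × ((length Y * ∣Stab∣ t ≡ length elements) ⇔ Transitive Y)
        × (length Y * ∣Stab∣ t ≡ length elements → SharplyTransitive Y)
      clique-case t∈ clique =
          clique-bound clique t∈
        , mk⇔ (λ tight → 1 , s≤s z≤n , clique-tight⇒sharply clique t∈ tight)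
              (λ transitiveY → clique∧transitive⇒tight clique transitiveY t∈)
        , clique-tight⇒sharply clique t∈

      transitive-case : IsPoint t → Transitive Y →
          (length elements ≤ length Y * ∣Stab∣ t)
        × ((length Y * ∣Stab∣ t ≡ length elements) ⇔ Clique Y)
        × (length Y * ∣Stab∣ t ≡ length elements → SharplyTransitive Y)
      transitive-case t∈ transitiveY =
          transitive-bound transitiveY t∈
        , mk⇔ (sharply⇒clique ∘ transitive∧tight⇒sharply transitiveY t∈)
              (λ clique → ≤-antisym (clique-bound clique t∈) (transitive-bound transitiveY t∈))
        , transitive∧tight⇒sharply transitiveY t∈

-- The wreath product G ≀ Sₙ acting on σ-tabloids

module _ {A : Set} (xs : List A) where

  allVecs-complete : (∀ x → x ∈ xs) → ∀ m (v : Vec A m) → v ∈ allVecs xs m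
  allVecs-complete every zero [] = here refl
  allVecs-complete every (suc m) (x ∷ v) =
    ∈-concat⁺′ (∈-map⁺ (x ∷_) (allVecs-complete every m v))
               (∈-map⁺ (λ y → map (y ∷_) (allVecs xs m)) (every x))

  allVecs-unique : Unique xs → ∀ m → Unique (allVecs xs m)
  allVecs-unique xs! zero = [] ∷ []
  allVecs-unique xs! (suc m) =
    Unique.concat⁺ (Allₚ.map⁺ (All.tabulate (λ _ → Unique.map⁺ Vec.∷-injectiveʳ (allVecs-unique xs! m))))
                   (AllPairsₚ.map⁺ (AllPairs.map disjoint xs!))
    where
    disjoint : ∀ {x y} → x ≢ y → ∀ {v} →
               v ∈ map (x ∷_) (allVecs xs m) × v ∈ map (y ∷_) (allVecs xs m) → ⊥
    disjoint x≢y (v∈x∷ , v∈y∷) with ∈-map⁻ _ v∈x∷ | ∈-map⁻ _ v∈y∷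
    ... | _ , _ , refl | _ , _ , x∷≡y∷ = x≢y (Vec.∷-injectiveˡ x∷≡y∷)

module WreathProduct (G : FiniteAbelianGroup) (n : ℕ) where
  open FiniteAbelianGroup G renaming (_+_ to _+ᴳ_)
  open Wreath G n

  abelianGroup : AbelianGroup 0ℓ 0ℓ
  abelianGroup = record { isAbelianGroup = isAbelianGroup }

  open AbelianGroup abelianGroup using (assoc; comm; identityˡ; identityʳ; inverseˡ; inverseʳ; commutativeSemigroup)
  open AbelianGroupProperties abelianGroup
    using (//-rightDividesˡ; //-rightDividesʳ; \\-leftDividesʳ; ⁻¹-anti-homo-∙; ⁻¹-anti-homo‿-)
  open CommutativeSemigroupProperties commutativeSemigroup using (x∙yz≈xz∙y)

  -ᴳ-cancelʳ : ∀ a b c → (a +ᴳ c) -ᴳ (b +ᴳ c) ≡ a -ᴳ b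
  -ᴳ-cancelʳ a b c = begin
    (a +ᴳ c) +ᴳ - (b +ᴳ c)    ≡⟨ cong ((a +ᴳ c) +ᴳ_) (⁻¹-anti-homo-∙ b c) ⟩
    (a +ᴳ c) +ᴳ (- c +ᴳ - b)  ≡⟨ assoc (a +ᴳ c) (- c) (- b) ⟨
    ((a +ᴳ c) -ᴳ c) +ᴳ - b    ≡⟨ cong (_+ᴳ - b) (//-rightDividesʳ c a) ⟩
    a -ᴳ b                    ∎
    where open ≡-Reasoning

  -ᴳ-trans : ∀ a b c → (a -ᴳ b) +ᴳ (b -ᴳ c) ≡ a -ᴳ c
  -ᴳ-trans a b c = trans (assoc a (- b) (b -ᴳ c)) (cong (a +ᴳ_) (\\-leftDividesʳ b (- c)))

  +ᴳ-difference : ∀ a b → a +ᴳ (b -ᴳ a) ≡ b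
  +ᴳ-difference a b = trans (comm a (b -ᴳ a)) (//-rightDividesˡ a b)

  lookup-invPerm : ∀ π → IsPerm π → ∀ j → lookup π (invPerm π j) ≡ j
  lookup-invPerm π (_ , surjective) j =
    head-filter-satisfies (λ i → lookup π i ≟ j) j (∈-allFin (proj₁ (surjective j))) (proj₂ (surjective j))

  invPerm-lookup : ∀ π → IsPerm π → ∀ i → invPerm π (lookup π i) ≡ i
  invPerm-lookup π π-perm i = proj₁ π-perm _ _ (lookup-invPerm π π-perm (lookup π i))

  module _ {f g : Fin n → Fin n} (g∘f : ∀ i → g (f i) ≡ i) (f∘g : ∀ j → f (g j) ≡ j) where

    tabulate-IsPerm : IsPerm (tabulate f)
    tabulate-IsPerm = injective , λ j → g j , trans (Vec.lookup∘tabulate f (g j)) (f∘g j)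
      where
      injective : ∀ i j → lookup (tabulate f) i ≡ lookup (tabulate f) j → i ≡ j
      injective i j fi≡fj = begin
        i          ≡⟨ g∘f i ⟨
        g (f i)    ≡⟨ cong g (trans (sym (Vec.lookup∘tabulate f i))
                                    (trans fi≡fj (Vec.lookup∘tabulate f j))) ⟩
        g (f j)    ≡⟨ g∘f j ⟩
        j          ∎
        where open ≡-Reasoning

    invPerm-tabulate : ∀ j → invPerm (tabulate f) j ≡ g j
    invPerm-tabulate j = trans (cong (invPerm (tabulate f)) (sym (trans (Vec.lookup∘tabulate f (g j)) (f∘g j))))
      (invPerm-lookup (tabulate f) tabulate-IsPerm (g j))

  module _ (π τ : Vec (Fin n) n) (π-perm : IsPerm π) (τ-perm : IsPerm τ) where
    private
      g∘f : ∀ i → invPerm τ (invPerm π (lookup π (lookup τ i))) ≡ i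
      g∘f i = trans (cong (invPerm τ) (invPerm-lookup π π-perm _)) (invPerm-lookup τ τ-perm i)
      f∘g : ∀ j → lookup π (lookup τ (invPerm τ (invPerm π j))) ≡ j
      f∘g j = trans (cong (lookup π) (lookup-invPerm τ τ-perm _)) (lookup-invPerm π π-perm j)

    composition-IsPerm : IsPerm (tabulate (λ i → lookup π (lookup τ i)))
    composition-IsPerm = tabulate-IsPerm g∘f f∘g

    invPerm-composition : ∀ j → invPerm (tabulate (λ i → lookup π (lookup τ i))) j ≡ invPerm τ (invPerm π j)
    invPerm-composition = invPerm-tabulate g∘f f∘g

  module _ (π : Vec (Fin n) n) (π-perm : IsPerm π) where

    inverse-IsPerm : IsPerm (tabulate (invPerm π))
    inverse-IsPerm = tabulate-IsPerm (lookup-invPerm π π-perm) (invPerm-lookup π π-perm)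

    invPerm-inverse : ∀ j → invPerm (tabulate (invPerm π)) j ≡ lookup π j
    invPerm-inverse = invPerm-tabulate (lookup-invPerm π π-perm) (invPerm-lookup π π-perm)

  invPerm-identity : ∀ j → invPerm (tabulate id) j ≡ j
  invPerm-identity = invPerm-tabulate (λ _ → refl) (λ _ → refl)

  ε : Wel
  ε = (tabulate (λ _ → 0#) , tabulate id)

  private
    variable
      x y z : Wel

  Wel-ext : (∀ j → lookup (proj₁ x) j ≡ lookup (proj₁ y) j) →
            (∀ i → lookup (proj₂ x) i ≡ lookup (proj₂ y) i) → x ≡ y
  Wel-ext shifts perms = cong₂ _,_ (Pointwise-≡⇒≡ (ext shifts)) (Pointwise-≡⇒≡ (ext perms))

  shift-· : ∀ x y j →
            lookup (proj₁ (x · y)) j ≡ lookup (proj₁ x) j +ᴳ lookup (proj₁ y) (invPerm (proj₂ x) j)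
  shift-· x y = Vec.lookup∘tabulate _

  perm-· : ∀ x y i → lookup (proj₂ (x · y)) i ≡ lookup (proj₂ x) (lookup (proj₂ y) i)
  perm-· x y = Vec.lookup∘tabulate _

  ·-InW : InW x → InW y → InW (x · y)
  ·-InW {x} {y} = composition-IsPerm (proj₂ x) (proj₂ y)

  ⁻¹-InW : InW x → InW (x ⁻¹)
  ⁻¹-InW {x} = inverse-IsPerm (proj₂ x)

  ·-assoc : InW x → InW y → (x · y) · z ≡ x · (y · z)
  ·-assoc {x} {y} {z} x∈ y∈ = Wel-ext shifts perms
    where
    open ≡-Reasoning
    f g h : Fin n → Fin k
    f = lookup (proj₁ x)
    g = lookup (proj₁ y)
    h = lookup (proj₁ z)
    π τ : Vec (Fin n) n
    π = proj₂ x
    τ = proj₂ y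
    shifts : ∀ j → lookup (proj₁ ((x · y) · z)) j ≡ lookup (proj₁ (x · (y · z))) j
    shifts j = begin
      lookup (proj₁ ((x · y) · z)) j
        ≡⟨ shift-· (x · y) z j ⟩
      lookup (proj₁ (x · y)) j +ᴳ h (invPerm (proj₂ (x · y)) j)
        ≡⟨ cong₂ _+ᴳ_ (shift-· x y j) (cong h (invPerm-composition π τ x∈ y∈ j)) ⟩
      (f j +ᴳ g (invPerm π j)) +ᴳ h (invPerm τ (invPerm π j))
        ≡⟨ assoc _ _ _ ⟩
      f j +ᴳ (g (invPerm π j) +ᴳ h (invPerm τ (invPerm π j)))
        ≡⟨ cong (f j +ᴳ_) (shift-· y z (invPerm π j)) ⟨
      f j +ᴳ lookup (proj₁ (y · z)) (invPerm π j)
        ≡⟨ shift-· x (y · z) j ⟨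
      lookup (proj₁ (x · (y · z))) j ∎
    perms : ∀ i → lookup (proj₂ ((x · y) · z)) i ≡ lookup (proj₂ (x · (y · z))) i
    perms i = begin
      lookup (proj₂ ((x · y) · z)) i               ≡⟨ perm-· (x · y) z i ⟩
      lookup (proj₂ (x · y)) (lookup (proj₂ z) i)  ≡⟨ perm-· x y _ ⟩
      lookup π (lookup τ (lookup (proj₂ z) i))     ≡⟨ cong (lookup π) (perm-· y z i) ⟨
      lookup π (lookup (proj₂ (y · z)) i)          ≡⟨ perm-· x (y · z) i ⟨
      lookup (proj₂ (x · (y · z))) i               ∎

  ·-identityˡ : ε · x ≡ x
  ·-identityˡ {x} = Wel-ext shifts perms
    where
    open ≡-Reasoning
    f : Fin n → Fin k
    f = lookup (proj₁ x)
    shifts : ∀ j → lookup (proj₁ (ε · x)) j ≡ f j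
    shifts j = begin
      lookup (proj₁ (ε · x)) j
        ≡⟨ shift-· ε x j ⟩
      lookup (tabulate (λ _ → 0#)) j +ᴳ f (invPerm (tabulate id) j)
        ≡⟨ cong₂ _+ᴳ_ (Vec.lookup∘tabulate _ j) (cong f (invPerm-identity j)) ⟩
      0# +ᴳ f j
        ≡⟨ identityˡ _ ⟩
      f j ∎
    perms : ∀ i → lookup (proj₂ (ε · x)) i ≡ lookup (proj₂ x) i
    perms i = trans (perm-· ε x i) (Vec.lookup∘tabulate id _)

  ·-identityʳ : x · ε ≡ x
  ·-identityʳ {x} = Wel-ext shifts perms
    where
    open ≡-Reasoning
    f : Fin n → Fin k
    f = lookup (proj₁ x)
    shifts : ∀ j → lookup (proj₁ (x · ε)) j ≡ f j
    shifts j = begin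
      lookup (proj₁ (x · ε)) j
        ≡⟨ shift-· x ε j ⟩
      f j +ᴳ lookup (tabulate (λ _ → 0#)) (invPerm (proj₂ x) j)
        ≡⟨ cong (f j +ᴳ_) (Vec.lookup∘tabulate (λ _ → 0#) (invPerm (proj₂ x) j)) ⟩
      f j +ᴳ 0#
        ≡⟨ identityʳ _ ⟩
      f j ∎
    perms : ∀ i → lookup (proj₂ (x · ε)) i ≡ lookup (proj₂ x) i
    perms i = trans (perm-· x ε i) (cong (lookup (proj₂ x)) (Vec.lookup∘tabulate id i))

  ·-inverseˡ : InW x → (x ⁻¹) · x ≡ ε
  ·-inverseˡ {x} x∈ = Wel-ext shifts perms
    where
    open ≡-Reasoning
    f : Fin n → Fin k
    f = lookup (proj₁ x)
    π : Vec (Fin n) n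
    π = proj₂ x
    shifts : ∀ j → lookup (proj₁ ((x ⁻¹) · x)) j ≡ lookup (proj₁ ε) j
    shifts j = begin
      lookup (proj₁ ((x ⁻¹) · x)) j
        ≡⟨ shift-· (x ⁻¹) x j ⟩
      lookup (proj₁ (x ⁻¹)) j +ᴳ f (invPerm (tabulate (invPerm π)) j)
        ≡⟨ cong₂ _+ᴳ_ (Vec.lookup∘tabulate _ j) (cong f (invPerm-inverse π x∈ j)) ⟩
      - f (lookup π j) +ᴳ f (lookup π j)
        ≡⟨ inverseˡ _ ⟩
      0#
        ≡⟨ Vec.lookup∘tabulate _ j ⟨
      lookup (proj₁ ε) j ∎
    perms : ∀ i → lookup (proj₂ ((x ⁻¹) · x)) i ≡ lookup (proj₂ ε) i
    perms i = begin
      lookup (proj₂ ((x ⁻¹) · x)) i               ≡⟨ perm-· (x ⁻¹) x i ⟩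
      lookup (tabulate (invPerm π)) (lookup π i)  ≡⟨ Vec.lookup∘tabulate (invPerm π) (lookup π i) ⟩
      invPerm π (lookup π i)                      ≡⟨ invPerm-lookup π x∈ i ⟩
      i                                           ≡⟨ Vec.lookup∘tabulate id i ⟨
      lookup (proj₂ ε) i                          ∎

  ·-inverseʳ : InW x → x · (x ⁻¹) ≡ ε
  ·-inverseʳ {x} x∈ = Wel-ext shifts perms
    where
    open ≡-Reasoning
    f : Fin n → Fin k
    f = lookup (proj₁ x)
    π : Vec (Fin n) n
    π = proj₂ x
    shifts : ∀ j → lookup (proj₁ (x · (x ⁻¹))) j ≡ lookup (proj₁ ε) j
    shifts j = begin
      lookup (proj₁ (x · (x ⁻¹))) j
        ≡⟨ shift-· x (x ⁻¹) j ⟩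
      f j +ᴳ lookup (proj₁ (x ⁻¹)) (invPerm π j)
        ≡⟨ cong (f j +ᴳ_) (Vec.lookup∘tabulate (λ i → - f (lookup π i)) (invPerm π j)) ⟩
      f j +ᴳ - f (lookup π (invPerm π j))
        ≡⟨ cong (λ i → f j +ᴳ - f i) (lookup-invPerm π x∈ j) ⟩
      f j +ᴳ - f j
        ≡⟨ inverseʳ _ ⟩
      0#
        ≡⟨ Vec.lookup∘tabulate _ j ⟨
      lookup (proj₁ ε) j ∎
    perms : ∀ i → lookup (proj₂ (x · (x ⁻¹))) i ≡ lookup (proj₂ ε) i
    perms i = begin
      lookup (proj₂ (x · (x ⁻¹))) i               ≡⟨ perm-· x (x ⁻¹) i ⟩
      lookup π (lookup (tabulate (invPerm π)) i)   ≡⟨ cong (lookup π) (Vec.lookup∘tabulate _ i) ⟩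
      lookup π (invPerm π i)                       ≡⟨ lookup-invPerm π x∈ i ⟩
      i                                            ≡⟨ Vec.lookup∘tabulate id i ⟨
      lookup (proj₂ ε) i                           ∎

  private
    variable
      e e′ e″ : Entry
      a b : TabloidRep

  ≈ₑ-refl : IsSubgroup (sub e) → e ≈ₑ e
  ≈ₑ-refl {e} (0∈U , _ , _) = refl , refl , subst (_∈ₛ sub e) (sym (inverseʳ (coset e))) 0∈U

  ≈ₑ-sym : IsSubgroup (sub e) → e ≈ₑ e′ → e′ ≈ₑ e
  ≈ₑ-sym {e} (_ , _ , −-closed) (refl , refl , e-e′∈U) =
    refl , refl , subst (_∈ₛ sub e) (⁻¹-anti-homo‿- _ _) (−-closed _ e-e′∈U)

  ≈ₑ-trans : IsSubgroup (sub e) → e ≈ₑ e′ → e′ ≈ₑ e″ → e ≈ₑ e″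
  ≈ₑ-trans {e} (_ , +-closed , _) (refl , refl , e-e′∈U) (refl , refl , e′-e″∈U) =
    refl , refl , subst (_∈ₛ sub e) (-ᴳ-trans _ _ _) (+-closed _ _ e-e′∈U e′-e″∈U)

  SubgroupValued : TabloidRep → Set
  SubgroupValued a = ∀ i → IsSubgroup (sub (a i))

  ≈-refl : SubgroupValued a → a ≈ a
  ≈-refl a-sub i = ≈ₑ-refl (a-sub i)

  ≈-sym : SubgroupValued a → a ≈ b → b ≈ a
  ≈-sym a-sub a≈b i = ≈ₑ-sym (a-sub i) (a≈b i)

  ≈-trans : ∀ {a b c} → SubgroupValued a → a ≈ b → b ≈ c → a ≈ c
  ≈-trans a-sub a≈b b≈c i = ≈ₑ-trans (a-sub i) (a≈b i) (b≈c i)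

  ≗⇒≈ : SubgroupValued a → a ≗ b → a ≈ b
  ≗⇒≈ {a} a-sub a≗b i = subst (a i ≈ₑ_) (a≗b i) (≈ₑ-refl (a-sub i))

  act-SubgroupValued : ∀ w a → SubgroupValued a → SubgroupValued (act w a)
  act-SubgroupValued w a a-sub = a-sub ∘ invPerm (proj₂ w)

  act-cong : ∀ w → a ≈ b → act w a ≈ act w b
  act-cong {a} w a≈b j with a≈b (invPerm (proj₂ w) j)
  ... | sub≡ , row≡ , a-b∈U =
    sub≡ , row≡ , subst (_∈ₛ sub (a (invPerm (proj₂ w) j))) (sym (-ᴳ-cancelʳ _ _ _)) a-b∈U

  act-· : InW x → InW y → ∀ a → act (x · y) a ≗ act x (act y a)
  act-· {x} {y} x∈ y∈ a j rewrite invPerm-composition (proj₂ x) (proj₂ y) x∈ y∈ j =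
    cong (entry _ _) (trans (cong (_ +ᴳ_) (shift-· x y j)) (x∙yz≈xz∙y _ _ _))

  act-ε : ∀ a → act ε a ≗ a
  act-ε a j rewrite invPerm-identity j =
    cong (entry _ _) (trans (cong (coset (a j) +ᴳ_) (Vec.lookup∘tabulate _ j)) (identityʳ _))

  Wlist-unique : Unique Wlist
  Wlist-unique = Unique.cartesianProduct⁺ (allVecs-unique (allFin k) (Unique.allFin⁺ k) n)
                   (Unique.filter⁺ IsPerm? (allVecs-unique (allFin n) (Unique.allFin⁺ n) n))

  ∈-Wlist : InW x → x ∈ Wlist
  ∈-Wlist {g , π} π-perm = ∈-cartesianProduct⁺ (allVecs-complete (allFin k) ∈-allFin n g)
    (∈-filter⁺ IsPerm? (allVecs-complete (allFin n) ∈-allFin n π) π-perm)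

  Wlist-InW : x ∈ Wlist → InW x
  Wlist-InW x∈ = proj₂ (∈-filter⁻ IsPerm? {xs = allVecs (allFin n) n}
    (proj₂ (∈-cartesianProduct⁻ (allVecs (allFin k) n) (filter IsPerm? (allVecs (allFin n) n)) x∈)))

  wreathGroup : FiniteGroup
  wreathGroup = record
    { Carrier            = Wel
    ; IsElement          = InW
    ; elements           = Wlist
    ; elements-unique    = Wlist-unique
    ; ∈-elements         = λ {x} → ∈-Wlist {x}
    ; elements-IsElement = λ {x} → Wlist-InW {x}
    ; _·_                = _·_
    ; _⁻¹                = _⁻¹
    ; ε                  = ε
    ; ·-IsElement        = λ {x} {y} → ·-InW {x} {y}
    ; ⁻¹-IsElement       = λ {x} → ⁻¹-InW {x}
    ; assoc              = λ {x} {y} {z} x∈ y∈ _ → ·-assoc {x} {y} {z} x∈ y∈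
    ; identityˡ          = λ _ → ·-identityˡ
    ; identityʳ          = λ _ → ·-identityʳ
    ; inverseˡ           = λ {x} → ·-inverseˡ {x}
    ; inverseʳ           = λ {x} → ·-inverseʳ {x}
    }

  IsSubgroup? : ∀ U → Dec (IsSubgroup U)
  IsSubgroup? U = (0# ∈? U)
    ×-dec all? (λ x → all? (λ y → (x ∈? U) →-dec ((y ∈? U) →-dec ((x +ᴳ y) ∈? U))))
    ×-dec all? (λ x → (x ∈? U) →-dec ((- x) ∈? U))

  module Tabloids (σ : Subset k → List ℕ) (σ∈Σ : InΣ σ) where

    tabloid-SubgroupValued : ∀ a → IsTabloid σ a → SubgroupValued a
    tabloid-SubgroupValued a (in-rows , _) i = decidable-stable (IsSubgroup? (sub (a i))) λ ¬subgroup →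
      n≮0 (subst (λ rows → row (a i) < length rows) (proj₁ (proj₂ σ∈Σ) _ ¬subgroup) (in-rows i))

    act-IsTabloid : ∀ w → InW w → IsTabloid σ a → IsTabloid σ (act w a)
    act-IsTabloid {a} (g , π) π-perm (in-rows , row-sizes) = in-rows ∘ invPerm π , λ U r →
      trans (count-∘-bijection (Unique.allFin⁺ n) (λ _ → ∈-allFin _) (λ _ → ∈-allFin _)
               (λ {i} _ → lookup-invPerm π π-perm i) (λ {i} _ → invPerm-lookup π π-perm i)
               (λ i → (Vec.≡-dec _≟B_ (sub (a i)) U) ×-dec (row (a i) ≟ℕ toℕ r)))
            (row-sizes U r)

    -- key a i names the row holding i, so the fibres of key a are the rows of the shape σ.
    key : TabloidRep → Fin n → Subset k × ℕ
    key a i = sub (a i) , row (a i)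

    _≟key_ : DecidableEquality (Subset k × ℕ)
    _≟key_ = ×-≡-dec (Vec.≡-dec _≟B_) _≟ℕ_

    key-fibre-in-rows : ∀ a → IsTabloid σ a → ∀ {U m} (m< : m < length (σ U)) →
      count (λ i → key a i ≟key (U , m)) (allFin n) ≡ List.lookup (σ U) (fromℕ< m<)
    key-fibre-in-rows a (_ , row-sizes) {U} {m} m< =
      trans (count-cong (λ i → key a i ≟key (U , m)) in-row same-row) (row-sizes U (fromℕ< m<))
      where
      in-row : ∀ i → Dec (sub (a i) ≡ U × row (a i) ≡ toℕ (fromℕ< m<))
      in-row i = (Vec.≡-dec _≟B_ (sub (a i)) U) ×-dec (row (a i) ≟ℕ toℕ (fromℕ< m<))
      same-row : ∀ {i} → i ∈ allFin n → key a i ≡ (U , m) ⇔ (sub (a i) ≡ U × row (a i) ≡ toℕ (fromℕ< m<))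
      same-row _ = mk⇔ (λ key≡ → cong proj₁ key≡ , trans (cong proj₂ key≡) (sym (toℕ-fromℕ< m<)))
                       (λ (sub≡ , row≡) → cong₂ _,_ sub≡ (trans row≡ (toℕ-fromℕ< m<)))

    key-fibre-beyond-rows : ∀ a → IsTabloid σ a → ∀ {U m} → ¬ m < length (σ U) →
      count (λ i → key a i ≟key (U , m)) (allFin n) ≡ 0
    key-fibre-beyond-rows a (in-rows , _) {U} {m} m≮ =
      cong length (filter-none (λ i → key a i ≟key (U , m)) (All.tabulate outside))
      where
      outside : ∀ {i} → i ∈ allFin n → key a i ≢ (U , m)
      outside {i} _ key≡ = m≮ (subst (λ κ → proj₂ κ < length (σ (proj₁ κ))) key≡ (in-rows i))

    tabloid-key-fibres : ∀ a b → IsTabloid σ a → IsTabloid σ b → ∀ κ →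
      count (λ i → key a i ≟key κ) (allFin n) ≡ count (λ i → key b i ≟key κ) (allFin n)
    tabloid-key-fibres a b a-tab b-tab (U , m) with m <? length (σ U)
    ... | yes m< = trans (key-fibre-in-rows a a-tab m<) (sym (key-fibre-in-rows b b-tab m<))
    ... | no m≮ = trans (key-fibre-beyond-rows a a-tab m≮) (sym (key-fibre-beyond-rows b b-tab m≮))

    tabloids-transitive : ∀ a b → IsTabloid σ a → IsTabloid σ b → ∃ λ w → InW w × act w a ≈ b
    tabloids-transitive a b a-tab b-tab = (shifts , π) , π-perm , moved
      where
      permutation : ∃ λ (ρ : Permutation′ n) → ∀ i → key b (ρ ⟨$⟩ʳ i) ≡ key a i
      permutation = equal-fibres⇒permutation _≟key_ (tabloid-key-fibres a b a-tab b-tab)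
      ρ : Permutation′ n
      ρ = proj₁ permutation
      π : Vec (Fin n) n
      π = tabulate (ρ ⟨$⟩ʳ_)
      π-perm : IsPerm π
      π-perm = tabulate-IsPerm (λ _ → Perm.inverseˡ ρ) (λ _ → Perm.inverseʳ ρ)
      shifts : Vec (Fin k) n
      shifts = tabulate (λ j → coset (b j) -ᴳ coset (a (invPerm π j)))
      moved : act (shifts , π) a ≈ b
      moved j =
        cong proj₁ same-key , cong proj₂ same-key , subst (_∈ₛ sub (a i)) (sym coset-difference≡0) 0∈U
        where
        i : Fin n
        i = invPerm π j
        same-key : key a i ≡ key b j
        same-key = trans (sym (proj₂ permutation i))
          (cong (key b) (trans (sym (Vec.lookup∘tabulate (ρ ⟨$⟩ʳ_) i)) (lookup-invPerm π π-perm j)))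
        coset-difference≡0 : (coset (a i) +ᴳ lookup shifts j) -ᴳ coset (b j) ≡ 0#
        coset-difference≡0 = begin
          (coset (a i) +ᴳ lookup shifts j) -ᴳ coset (b j)
            ≡⟨ cong (λ s → (coset (a i) +ᴳ s) -ᴳ coset (b j)) (Vec.lookup∘tabulate _ j) ⟩
          (coset (a i) +ᴳ (coset (b j) -ᴳ coset (a i))) -ᴳ coset (b j)
            ≡⟨ cong (_-ᴳ coset (b j)) (+ᴳ-difference _ _) ⟩
          coset (b j) -ᴳ coset (b j)
            ≡⟨ inverseʳ _ ⟩
          0# ∎
          where open ≡-Reasoning
        0∈U : 0# ∈ₛ sub (a i)
        0∈U = proj₁ (tabloid-SubgroupValued a a-tab i)

    wreathAction : GroupAction wreathGroup
    wreathAction = record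
      { Point       = TabloidRep
      ; IsPoint     = IsTabloid σ
      ; _≈_         = _≈_
      ; _≈?_        = _≈?_
      ; ≈-refl      = λ {a} → ≈-refl ∘ tabloid-SubgroupValued a
      ; ≈-sym       = λ {a} → ≈-sym ∘ tabloid-SubgroupValued a
      ; ≈-trans     = λ {a} → ≈-trans ∘ tabloid-SubgroupValued a
      ; act         = act
      ; act-IsPoint = λ {w} {a} → act-IsTabloid {a} w
      ; act-cong    = λ {w} → act-cong w
      ; act-·       = λ {x} {y} {a} x∈ y∈ a-tab →
                        ≗⇒≈ (act-SubgroupValued (x · y) a (tabloid-SubgroupValued a a-tab)) (act-· {x} {y} x∈ y∈ a)
      ; act-ε       = λ {a} a-tab → ≗⇒≈ (act-SubgroupValued ε a (tabloid-SubgroupValued a a-tab)) (act-ε a)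
      }

theorem4p11 :
    (G : FiniteAbelianGroup) (n : ℕ) → 1 ≤ n →
    (σ : Subset (FiniteAbelianGroup.order G) → List ℕ) → Wreath.InΣ G n σ →
    (t : Wreath.TabloidRep G n) → Wreath.IsTabloid G n σ t →
    (Y : List (Wreath.Wel G n)) → All (Wreath.InW G n) Y → Unique Y → Y ≢ [] →
    -- (a)
    (Wreath.Clique G n σ Y →
        (length Y * Wreath.∣Stab∣ G n t ≤ Wreath.∣W∣ G n)
      × ((length Y * Wreath.∣Stab∣ G n t ≡ Wreath.∣W∣ G n) ⇔ Wreath.Transitive G n σ Y)
      × (length Y * Wreath.∣Stab∣ G n t ≡ Wreath.∣W∣ G n → Wreath.SharplyTransitive G n σ Y))
    ×
    -- (b)
    (Wreath.Transitive G n σ Y →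
        (Wreath.∣W∣ G n ≤ length Y * Wreath.∣Stab∣ G n t)
      × ((length Y * Wreath.∣Stab∣ G n t ≡ Wreath.∣W∣ G n) ⇔ Wreath.Clique G n σ Y)
      × (length Y * Wreath.∣Stab∣ G n t ≡ Wreath.∣W∣ G n → Wreath.SharplyTransitive G n σ Y))
theorem4p11 G n _ σ σ∈Σ t t-tabloid Y Y-elements Y-unique _ =
    clique-case tabloids-transitive Y-elements Y-unique t-tabloid
  , transitive-case tabloids-transitive Y-elements Y-unique t-tabloid
  where
  open WreathProduct.Tabloids G n σ σ∈Σ using (wreathAction; tabloids-transitive)
  open DoubleCounting wreathAction using (clique-case; transitive-case)
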